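{- Let $\ell\ge 2$, let $D=(b|g;f_1,\dots,f_\ell)=(d_{n,k})_{n,k\ge0}$ be a multiple almost-Riordan array, and let $h=\sqrt[\ell]{f_1f_2\cdots f_\ell}$. For a formal power series $u(t)=\sum_{n\ge0}u_nt^n$, identify $u$ with the column vector $(u_0,u_1,u_2,\dots)^T$, and let $v(t)$ be the generating function of the column vector $Du$. Then: (i) if $u(t)=\sum_{k\ge0}u_{\ell k}t^{\ell k}\in\mathbb K[[t^\ell]]$, then $v(t)=u_0\,b(t)+\dfrac{t\,g(t)}{f_\ell(t)}\bigl(u(h)-u_0\bigr)$; (ii) if $u(t)=\sum_{k\ge0}u_{\ell k+1}t^{\ell k+1}$, then $v(t)=\dfrac{t\,g(t)}{h(t)}\,u(h)$; (iii) for $j\in\{2,3,\dots,\ell-1\}$, if $u(t)=\sum_{k\ge0}u_{\ell k+j}t^{\ell k+j}$, then $v(t)=\dfrac{t\,g(t)f_1(t)f_2(t)\cdots f_{j-1}(t)}{h(t)^j}\,u(h)$.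
   Context: Fix an integer $\ell\ge2$ and a field $\mathbb K$ of characteristic $0$; $\mathbb K[[t^\ell]]$ denotes the formal power series in $t^\ell$ and $t\mathbb K[[t^\ell]]=\{t\,w:w\in\mathbb K[[t^\ell]]\}$. Let $b,g\in\mathbb K[[t^\ell]]$ with $b_0:=b(0)\ne0$, $g_0:=g(0)\ne0$, and $f_1,\dots,f_\ell\in t\mathbb K[[t^\ell]]$, $f_j(t)=\sum_{k\ge0}f_{j,\ell k+1}t^{\ell k+1}$ with $f_{j,1}\ne0$. The multiple almost-Riordan array $(b|g;f_1,\dots,f_\ell)$ is the infinite lower triangular matrix $(d_{n,k})_{n,k\ge0}$ with $d_{n,0}=[t^n]b(t)$ and, for $k\ge1$, $d_{n,k}=[t^n]\,t\,g\,f_1^{e_1(k)}f_2^{e_2(k)}\cdots f_\ell^{e_\ell(k)}$ where $e_i(k)=\lfloor (k-1+\ell-i)/\ell\rfloor$; i.e. its columns have generating functions $b,\ tg,\ tgf_1,\ tgf_1f_2,\dots,\ tgf_1\cdots f_\ell,\ tgf_1^2f_2\cdots f_\ell,\ tgf_1^2f_2^2f_3\cdots f_\ell,\dots$. Here $h\in t\mathbb K[[t]]$ denotes a formal power series with $h^\ell=f_1f_2\cdots f_\ell$ (assumed to exist, e.g. when $\mathbb K$ is algebraically closed), and $u(h)$ denotes composition of $u$ with $h$. -}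

module Defs where

open import Level using (Level; _⊔_) renaming (suc to lsuc)
open import Algebra.Bundles using (CommutativeRing)
open import Data.Nat using (ℕ; zero; suc; _/_)
import Data.Nat as Nat
open import Data.Fin using (Fin; toℕ)
open import Data.Vec using (Vec; []; _∷_; head; lookup)
open import Relation.Nullary using (¬_)
open import Relation.Binary.PropositionalEquality using (_≡_)

record Field (c r : Level) : Set (lsuc (c ⊔ r)) where
  field
    commutativeRing : CommutativeRing c r
  open CommutativeRing commutativeRing public
  field
    _⁻¹       : Carrier → Carrier
    ⁻¹-inverse : ∀ x → ¬ (x ≈ 0#) → (x * (x ⁻¹)) ≈ 1#
    0≉1       : ¬ (0# ≈ 1#)

-- floor division, with the convention n ÷ 0 = 0 (only used with ℓ ≥ 2)
quot : ℕ → ℕ → ℕ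
quot n zero    = 0
quot n (suc m) = n / suc m

-- e_i(k) = ⌊(k - 1 + ℓ - i)/ℓ⌋ (used for k ≥ 1, 1 ≤ i ≤ ℓ)
expo : (ℓ i k : ℕ) → ℕ
expo ℓ i k = quot ((k Nat.∸ 1) Nat.+ (ℓ Nat.∸ i)) ℓ

module Series {c r : Level} (F : Field c r) where
  open Field F

  nat : ℕ → Carrier
  nat zero    = 0#
  nat (suc n) = 1# + nat n

  CharZero : Set r
  CharZero = ∀ n → ¬ (nat (suc n) ≈ 0#)

  PS : Set c
  PS = ℕ → Carrier

  _≈S_ : PS → PS → Set r
  a ≈S b = ∀ n → a n ≈ b n

  sumTo : ℕ → (ℕ → Carrier) → Carrier
  sumTo zero    f = 0#
  sumTo (suc n) f = sumTo n f + f n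

  sumFin : ∀ {n} → (Fin n → Carrier) → Carrier
  sumFin {zero}  f = 0#
  sumFin {suc n} f = f Fin.zero + sumFin (λ i → f (Fin.suc i))

  constS : Carrier → PS
  constS x zero    = x
  constS x (suc n) = 0#

  oneS : PS
  oneS = constS 1#

  tS : PS
  tS zero          = 0#
  tS (suc zero)    = 1#
  tS (suc (suc n)) = 0#

  addS : PS → PS → PS
  addS a b n = a n + b n

  subS : PS → PS → PS
  subS a b n = a n - b n

  scaleS : Carrier → PS → PS
  scaleS x a n = x * a n

  mulS : PS → PS → PS
  mulS a b n = sumTo (suc n) (λ k → a k * b (n Nat.∸ k))

  powS : PS → ℕ → PS
  powS a zero    = oneS
  powS a (suc n) = mulS a (powS a n)

  prodS : ℕ → (ℕ → PS) → PS
  prodS zero    f = oneS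
  prodS (suc n) f = mulS (prodS n f) (f (suc n))

  -- multiplicative inverse of a series with nonzero constant term
  -- (c_0 = a_0⁻¹, c_n = - a_0⁻¹ Σ_{k=1}^n a_k c_{n-k});
  -- invUpTo a n lists c_n, c_{n-1}, ..., c_0.
  invUpTo : PS → (n : ℕ) → Vec Carrier (suc n)
  invUpTo a zero    = (a 0 ⁻¹) ∷ []
  invUpTo a (suc n) =
    (- (a 0 ⁻¹) * sumFin (λ i → a (suc (toℕ i)) * lookup prev i)) ∷ prev
    where prev = invUpTo a n

  invS : PS → PS
  invS a n = head (invUpTo a n)

  -- quotient a / c of series where c has order m and t^m divides a:
  -- a / c = (a / t^m) · (c / t^m)⁻¹
  divS : ℕ → PS → PS → PS
  divS m a c = mulS (λ n → a (m Nat.+ n)) (invS (λ n → c (m Nat.+ n)))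

  -- composition u(h) for h with h(0) = 0: [t^n] u(h) = Σ_{k≤n} u_k [t^n] h^k
  compS : PS → PS → PS
  compS u h n = sumTo (suc n) (λ k → u k * powS h k n)

  -- s ∈ t^r K[[t^ℓ]] : all coefficients outside ℓℕ + r vanish
  InLat : ℕ → ℕ → PS → Set r
  InLat ℓ j s = ∀ n → (∀ k → ¬ (n ≡ k Nat.* ℓ Nat.+ j)) → s n ≈ 0#

  -- columns of the multiple almost-Riordan array (b | g ; f_1, ..., f_ℓ),
  -- with f i = f_i for 1 ≤ i ≤ ℓ
  column : (ℓ : ℕ) → PS → PS → (ℕ → PS) → ℕ → PS
  column ℓ b g f zero    = b
  column ℓ b g f (suc k) =
    mulS (mulS tS g) (prodS ℓ (λ i → powS (f i) (expo ℓ i (suc k))))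

  entry : (ℓ : ℕ) → PS → PS → (ℕ → PS) → ℕ → ℕ → Carrier
  entry ℓ b g f n k = column ℓ b g f k n

  -- the generating function of D u (D lower triangular)
  applyD : (ℓ : ℕ) → PS → PS → (ℕ → PS) → PS → PS
  applyD ℓ b g f u n = sumTo (suc n) (λ k → entry ℓ b g f n k * u k)

-- For k = mℓ + p + 1 with p < ℓ the exponents e_i(k) are m + 1 for i ≤ p and m for i > p, so
-- column k of D is t g f₁⋯f_p (f₁⋯f_ℓ)^m = q h^k for any q with q h^(p+1) = t g f₁⋯f_p.
-- Hence for u supported on ℓℕ + p + 1 we get D u = Σ_k u_k q h^k = q u(h).  Parts (ii) and (iii)
-- are the cases p = j - 1 with q = t g f₁⋯f_(j-1) / h^j; for (i) the constant term u₀ is sent to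
-- the column b and the rest of u is supported on ℓℕ + ℓ, where q = t g / f_ℓ works because
-- h^ℓ = f₁⋯f_ℓ.  The divisions are exact since h₁^ℓ = f_(1,1)⋯f_(ℓ,1) ≠ 0.
{-# OPTIONS --safe #-}
module Submission where

open import Defs
open import Level using (Level)
open import Data.Nat using (ℕ; _≤_; _<_)
open import Data.Product using (_×_)
open import Relation.Nullary using (¬_)

open import Algebra.Bundles using (CommutativeMonoid)
import Algebra.Properties.CommutativeSemigroup as CommutativeSemigroupProperties
import Algebra.Properties.AbelianGroup as AbelianGroupProperties
import Algebra.Properties.Ring as RingProperties
import Data.Nat as ℕ
open import Data.Nat using (zero; suc; z≤n; s≤s; NonZero; _≤′_; ≤′-refl; ≤′-step; _<?_; _≟_)
import Data.Nat.Properties as ℕₚ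
open import Data.Nat.Properties
  using (n<1+n; m<n⇒m<1+n; m≤n⇒m≤1+n; ≤-pred; ≤-refl; <⇒≤; ≤⇒≤′; ≤′⇒≤; ≮⇒≥; ≤∧≢⇒<; <-irrefl;
         m≤m+n; m∸n≤m; m+n∸m≡n; m∸[m∸n]≡n; +-∸-assoc; ∸-+-assoc; m+[n∸m]≡n; n∸n≡0; +-suc;
         suc-injective; 0≢1+n; 1+n≢0)
open import Data.Empty using (⊥-elim)
open import Data.Fin using (Fin; toℕ)
open import Data.Product using (∃-syntax; _,_; proj₁; proj₂)
open import Data.Sum using (_⊎_; inj₁; inj₂)
open import Data.Vec using (lookup)
open import Relation.Nullary using (yes; no)
open import Relation.Binary.PropositionalEquality using (_≡_; _≢_)
import Relation.Binary.PropositionalEquality as ≡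
import Relation.Binary.Reasoning.Setoid as SetoidReasoning

module Arithmetic where
  open import Data.Nat using (_+_; _*_; _∸_; _/_; _%_)
  open import Data.Nat.DivMod
    using (+-distrib-/-∣ʳ; m<n⇒m/n≡0; m*n/n≡m; %-remove-+ˡ; m<n⇒m%n≡m; m≡m%n+[m/n]*n)
  open import Data.Nat.Divisibility using (n∣m*n)
  open import Data.Nat.Properties using (+-comm; +-assoc; ≤-<-trans; ≤-trans; +-monoˡ-<; +-cancelˡ-<)
  open import Data.Nat.Tactic.RingSolver using (solve-∀)
  open import Relation.Nullary using (Dec)
  open ≡ using (refl; sym; trans; cong; cong₂; subst)

  n≤m⇒m<n+o⇒m∸n<o : ∀ {m n o} → n ≤ m → m < n + o → m ∸ n < o
  n≤m⇒m<n+o⇒m∸n<o {m} {n} {o} n≤m m<n+o =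
    +-cancelˡ-< n (m ∸ n) o (subst (_< n + o) (sym (m+[n∸m]≡n n≤m)) m<n+o)

  [r+m*n]/n≡m : ∀ {r n} m .{{_ : NonZero n}} → r < n → (r + m * n) / n ≡ m
  [r+m*n]/n≡m {r} {n} m r<n =
    trans (+-distrib-/-∣ʳ r (n∣m*n m)) (cong₂ _+_ (m<n⇒m/n≡0 r<n) (m*n/n≡m m n))

  [m*n+r]%n≡r : ∀ {r n} m .{{_ : NonZero n}} → r < n → (m * n + r) % n ≡ r
  [m*n+r]%n≡r {r} m r<n = trans (%-remove-+ˡ {m * _} r (n∣m*n m)) (m<n⇒m%n≡m r<n)

  quot≡/ : ∀ k ℓ .{{_ : NonZero ℓ}} → quot k ℓ ≡ k / ℓ
  quot≡/ k (suc ℓ) = refl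

  private
    regroup : ∀ a b c d → a + (b + c) + d ≡ c + (b + d + a)
    regroup = solve-∀

  expo-≤ : ∀ ℓ .{{_ : NonZero ℓ}} m {p i} → i ≤ p → p < ℓ →
           expo ℓ i (suc (m * ℓ + p)) ≡ suc m
  expo-≤ ℓ m {p} {i} i≤p p<ℓ = begin
    quot (m * ℓ + p + (ℓ ∸ i)) ℓ                ≡⟨ quot≡/ _ ℓ ⟩
    (m * ℓ + p + (ℓ ∸ i)) / ℓ                   ≡⟨ cong (λ x → (m * ℓ + x + (ℓ ∸ i)) / ℓ) (sym (m+[n∸m]≡n i≤p)) ⟩
    (m * ℓ + (i + (p ∸ i)) + (ℓ ∸ i)) / ℓ       ≡⟨ cong (_/ ℓ) (regroup (m * ℓ) i (p ∸ i) (ℓ ∸ i)) ⟩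
    ((p ∸ i) + (i + (ℓ ∸ i) + m * ℓ)) / ℓ       ≡⟨ cong (λ x → ((p ∸ i) + (x + m * ℓ)) / ℓ) (m+[n∸m]≡n i≤ℓ) ⟩
    ((p ∸ i) + suc m * ℓ) / ℓ                   ≡⟨ [r+m*n]/n≡m (suc m) (≤-<-trans (m∸n≤m p i) p<ℓ) ⟩
    suc m                                       ∎
    where
    open ≡.≡-Reasoning
    i≤ℓ : i ≤ ℓ
    i≤ℓ = ≤-trans i≤p (<⇒≤ p<ℓ)

  expo-> : ∀ ℓ .{{_ : NonZero ℓ}} m {p i} → p < i → i ≤ ℓ →
           expo ℓ i (suc (m * ℓ + p)) ≡ m
  expo-> ℓ m {p} {i} p<i i≤ℓ = begin
    quot (m * ℓ + p + (ℓ ∸ i)) ℓ                ≡⟨ quot≡/ _ ℓ ⟩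
    (m * ℓ + p + (ℓ ∸ i)) / ℓ                   ≡⟨ cong (_/ ℓ) (trans (+-assoc (m * ℓ) p _) (+-comm (m * ℓ) _)) ⟩
    (p + (ℓ ∸ i) + m * ℓ) / ℓ                   ≡⟨ [r+m*n]/n≡m m p+ℓ∸i<ℓ ⟩
    m                                           ∎
    where
    open ≡.≡-Reasoning
    p+ℓ∸i<ℓ : p + (ℓ ∸ i) < ℓ
    p+ℓ∸i<ℓ = subst (p + (ℓ ∸ i) <_) (m+[n∸m]≡n i≤ℓ) (+-monoˡ-< (ℓ ∸ i) p<i)

  residue? : ∀ {ℓ p} .{{_ : NonZero ℓ}} → p < ℓ → ∀ k → Dec (∃[ m ] k ≡ m * ℓ + p)
  residue? {ℓ} {p} p<ℓ k with k % ℓ ≟ p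
  ... | yes k%ℓ≡p = yes (k / ℓ , trans (m≡m%n+[m/n]*n k ℓ) (trans (cong (_+ k / ℓ * ℓ) k%ℓ≡p) (+-comm p _)))
  ... | no  k%ℓ≢p = no λ (m , k≡m*ℓ+p) → k%ℓ≢p (trans (cong (_% ℓ) k≡m*ℓ+p) ([m*n+r]%n≡r m p<ℓ))

open Arithmetic using (n≤m⇒m<n+o⇒m∸n<o; expo-≤; expo->; residue?)

module PowerSeries {c r : Level} (F : Field c r) where
  open Field F
  open Series F
  open RingProperties ring using (-1*x≈-x; -‿distribʳ-*)
  open AbelianGroupProperties +-abelianGroup using (xyx⁻¹≈y)
  open CommutativeSemigroupProperties *-commutativeSemigroup using () renaming (x∙yz≈y∙xz to *-x∙yz≈y∙xz)
  open CommutativeSemigroupProperties +-commutativeSemigroup using () renaming (interchange to +-interchange)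

  infixl 30 _*S_
  _*S_ : PS → PS → PS
  _*S_ = mulS

  infixr 31 _^S_
  _^S_ : PS → ℕ → PS
  _^S_ = powS

  sumTo-cong : ∀ n {G H : ℕ → Carrier} → (∀ k → k < n → G k ≈ H k) → sumTo n G ≈ sumTo n H
  sumTo-cong zero    G≈H = refl
  sumTo-cong (suc n) G≈H = +-cong (sumTo-cong n (λ k k<n → G≈H k (m<n⇒m<1+n k<n))) (G≈H n (n<1+n n))

  sumTo-zero : ∀ n {G : ℕ → Carrier} → (∀ k → k < n → G k ≈ 0#) → sumTo n G ≈ 0#
  sumTo-zero zero    G≈0 = refl
  sumTo-zero (suc n) G≈0 =
    trans (+-cong (sumTo-zero n (λ k k<n → G≈0 k (m<n⇒m<1+n k<n))) (G≈0 n (n<1+n n))) (+-identityʳ 0#)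

  sumTo-+ : ∀ n G H → sumTo n (λ k → G k + H k) ≈ sumTo n G + sumTo n H
  sumTo-+ zero    G H = sym (+-identityʳ 0#)
  sumTo-+ (suc n) G H = trans (+-congʳ (sumTo-+ n G H)) (+-interchange _ _ _ _)

  *-distribˡ-sumTo : ∀ n x G → x * sumTo n G ≈ sumTo n (λ k → x * G k)
  *-distribˡ-sumTo zero    x G = zeroʳ x
  *-distribˡ-sumTo (suc n) x G = trans (distribˡ x _ _) (+-congʳ (*-distribˡ-sumTo n x G))

  *-distribʳ-sumTo : ∀ n x G → sumTo n G * x ≈ sumTo n (λ k → G k * x)
  *-distribʳ-sumTo zero    x G = zeroˡ x
  *-distribʳ-sumTo (suc n) x G = trans (distribʳ x _ _) (+-congʳ (*-distribʳ-sumTo n x G))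

  sumTo-head : ∀ n G → sumTo (suc n) G ≈ G 0 + sumTo n (λ k → G (suc k))
  sumTo-head zero    G = trans (+-identityˡ _) (sym (+-identityʳ _))
  sumTo-head (suc n) G = trans (+-congʳ (sumTo-head n G)) (+-assoc _ _ _)

  sumTo-comm : ∀ m n (G : ℕ → ℕ → Carrier) →
               sumTo m (λ i → sumTo n (G i)) ≈ sumTo n (λ j → sumTo m (λ i → G i j))
  sumTo-comm zero    n G = sym (sumTo-zero n (λ _ _ → refl))
  sumTo-comm (suc m) n G = trans (+-congʳ (sumTo-comm m n G)) (sym (sumTo-+ n _ _))

  sumTo-reverse : ∀ n G → sumTo (suc n) G ≈ sumTo (suc n) (λ k → G (n ℕ.∸ k))
  sumTo-reverse zero    G = refl
  sumTo-reverse (suc n) G =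
    trans (+-congʳ (sumTo-reverse n G)) (trans (+-comm _ _) (sym (sumTo-head (suc n) (λ k → G (suc n ℕ.∸ k)))))

  sumTo-single : ∀ n k {G} → k < n → (∀ i → i < n → i ≢ k → G i ≈ 0#) → sumTo n G ≈ G k
  sumTo-single (suc n) k k<1+n G≈0 with k ≟ n
  ... | yes ≡.refl =
    trans (+-congʳ (sumTo-zero n (λ i i<n → G≈0 i (m<n⇒m<1+n i<n) (λ { ≡.refl → <-irrefl ≡.refl i<n }))))
          (+-identityˡ _)
  ... | no  k≢n =
    trans (+-cong (sumTo-single n k (≤∧≢⇒< (≤-pred k<1+n) k≢n) (λ i i<n → G≈0 i (m<n⇒m<1+n i<n)))
                  (G≈0 n (n<1+n n) (λ n≡k → k≢n (≡.sym n≡k))))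
          (+-identityʳ _)

  sumTo-extend : ∀ {m n} G → m ≤′ n → (∀ k → m ≤ k → k < n → G k ≈ 0#) → sumTo n G ≈ sumTo m G
  sumTo-extend G ≤′-refl          G≈0 = refl
  sumTo-extend G (≤′-step m≤′n) G≈0 =
    trans (+-cong (sumTo-extend G m≤′n (λ k m≤k k<n → G≈0 k m≤k (m<n⇒m<1+n k<n)))
                  (G≈0 _ (≤′⇒≤ m≤′n) (n<1+n _)))
          (+-identityʳ _)

  sumTo-triangle : ∀ n (G : ℕ → ℕ → Carrier) →
    sumTo n (λ i → sumTo (suc i) (λ j → G j i)) ≈ sumTo n (λ j → sumTo (n ℕ.∸ j) (λ k → G j (j ℕ.+ k)))
  sumTo-triangle zero    G = refl
  sumTo-triangle (suc n) G = sym (begin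
    sumTo (suc n) (λ j → sumTo (suc n ℕ.∸ j) (λ k → G j (j ℕ.+ k)))
      ≈⟨ sumTo-cong (suc n) (λ j j<1+n → peel-last j (≤-pred j<1+n)) ⟩
    sumTo (suc n) (λ j → sumTo (n ℕ.∸ j) (λ k → G j (j ℕ.+ k)) + G j n)
      ≈⟨ sumTo-+ (suc n) _ _ ⟩
    sumTo (suc n) (λ j → sumTo (n ℕ.∸ j) (λ k → G j (j ℕ.+ k))) + sumTo (suc n) (λ j → G j n)
      ≈⟨ +-congʳ (trans (+-congˡ (reflexive (≡.cong (λ m → sumTo m (λ k → G n (n ℕ.+ k))) (n∸n≡0 n))))
                        (+-identityʳ _)) ⟩
    sumTo n (λ j → sumTo (n ℕ.∸ j) (λ k → G j (j ℕ.+ k))) + sumTo (suc n) (λ j → G j n)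
      ≈⟨ +-congʳ (sumTo-triangle n G) ⟨
    sumTo n (λ i → sumTo (suc i) (λ j → G j i)) + sumTo (suc n) (λ j → G j n)
      ∎)
    where
    open SetoidReasoning setoid
    peel-last : ∀ j → j ≤ n →
      sumTo (suc n ℕ.∸ j) (λ k → G j (j ℕ.+ k)) ≈ sumTo (n ℕ.∸ j) (λ k → G j (j ℕ.+ k)) + G j n
    peel-last j j≤n = trans (reflexive (≡.cong (λ m → sumTo m (λ k → G j (j ℕ.+ k))) (+-∸-assoc 1 j≤n)))
                            (+-congˡ (reflexive (≡.cong (G j) (m+[n∸m]≡n j≤n))))

  sumFin-sumTo : ∀ n {H : Fin n → Carrier} G → (∀ i → H i ≈ G (toℕ i)) → sumFin H ≈ sumTo n G
  sumFin-sumTo zero    G H≈G = refl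
  sumFin-sumTo (suc n) G H≈G =
    trans (+-cong (H≈G Fin.zero) (sumFin-sumTo n (λ k → G (suc k)) (λ i → H≈G (Fin.suc i)))) (sym (sumTo-head n G))

  ≈S-refl : ∀ {a} → a ≈S a
  ≈S-refl n = refl

  ≈S-sym : ∀ {a b} → a ≈S b → b ≈S a
  ≈S-sym a≈b n = sym (a≈b n)

  ≈S-trans : ∀ {a b d} → a ≈S b → b ≈S d → a ≈S d
  ≈S-trans a≈b b≈d n = trans (a≈b n) (b≈d n)

  ≡⇒≈S : ∀ {a b} → a ≡ b → a ≈S b
  ≡⇒≈S ≡.refl = ≈S-refl

  *S-cong : ∀ {a a′ b b′} → a ≈S a′ → b ≈S b′ → a *S b ≈S a′ *S b′
  *S-cong a≈a′ b≈b′ n = sumTo-cong (suc n) (λ k _ → *-cong (a≈a′ k) (b≈b′ (n ℕ.∸ k)))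

  *S-congˡ : ∀ a {b b′} → b ≈S b′ → a *S b ≈S a *S b′
  *S-congˡ a = *S-cong {a = a} ≈S-refl

  *S-congʳ : ∀ {a a′} b → a ≈S a′ → a *S b ≈S a′ *S b
  *S-congʳ b a≈a′ = *S-cong {b = b} a≈a′ ≈S-refl

  *S-comm : ∀ a b → a *S b ≈S b *S a
  *S-comm a b n = trans (sumTo-reverse n _) (sumTo-cong (suc n) (λ k k<1+n →
    trans (*-comm _ _) (*-congʳ (reflexive (≡.cong b (m∸[m∸n]≡n (≤-pred k<1+n)))))))

  *S-assoc : ∀ a b d → (a *S b) *S d ≈S a *S (b *S d)
  *S-assoc a b d n = begin
    sumTo (suc n) (λ i → (a *S b) i * d (n ℕ.∸ i))
      ≈⟨ sumTo-cong (suc n) (λ i _ → *-distribʳ-sumTo (suc i) _ _) ⟩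
    sumTo (suc n) (λ i → sumTo (suc i) (λ j → a j * b (i ℕ.∸ j) * d (n ℕ.∸ i)))
      ≈⟨ sumTo-triangle (suc n) (λ j i → a j * b (i ℕ.∸ j) * d (n ℕ.∸ i)) ⟩
    sumTo (suc n) (λ j → sumTo (suc n ℕ.∸ j) (λ k → a j * b (j ℕ.+ k ℕ.∸ j) * d (n ℕ.∸ (j ℕ.+ k))))
      ≈⟨ sumTo-cong (suc n) (λ j j<1+n → inner j (≤-pred j<1+n)) ⟩
    sumTo (suc n) (λ j → a j * (b *S d) (n ℕ.∸ j))
      ∎
    where
    open SetoidReasoning setoid
    inner : ∀ j → j ≤ n →
      sumTo (suc n ℕ.∸ j) (λ k → a j * b (j ℕ.+ k ℕ.∸ j) * d (n ℕ.∸ (j ℕ.+ k))) ≈ a j * (b *S d) (n ℕ.∸ j)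
    inner j j≤n = begin
      sumTo (suc n ℕ.∸ j) (λ k → a j * b (j ℕ.+ k ℕ.∸ j) * d (n ℕ.∸ (j ℕ.+ k)))
        ≈⟨ reflexive (≡.cong (λ m → sumTo m (λ k → a j * b (j ℕ.+ k ℕ.∸ j) * d (n ℕ.∸ (j ℕ.+ k))))
                             (+-∸-assoc 1 j≤n)) ⟩
      sumTo (suc (n ℕ.∸ j)) (λ k → a j * b (j ℕ.+ k ℕ.∸ j) * d (n ℕ.∸ (j ℕ.+ k)))
        ≈⟨ sumTo-cong (suc (n ℕ.∸ j)) (λ k _ → trans (*-assoc _ _ _)
             (*-congˡ (*-cong (reflexive (≡.cong b (m+n∸m≡n j k)))
                              (reflexive (≡.cong d (≡.sym (∸-+-assoc n j k))))))) ⟩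
      sumTo (suc (n ℕ.∸ j)) (λ k → a j * (b k * d (n ℕ.∸ j ℕ.∸ k)))
        ≈⟨ *-distribˡ-sumTo (suc (n ℕ.∸ j)) (a j) _ ⟨
      a j * (b *S d) (n ℕ.∸ j)
        ∎

  *S-identityˡ : ∀ a → oneS *S a ≈S a
  *S-identityˡ a n =
    trans (sumTo-head n _) (trans (+-cong (*-identityˡ _) (sumTo-zero n (λ k _ → zeroˡ _))) (+-identityʳ _))

  *S-identityʳ : ∀ a → a *S oneS ≈S a
  *S-identityʳ a = ≈S-trans (*S-comm a oneS) (*S-identityˡ a)

  *S-commutativeMonoid : CommutativeMonoid c r
  *S-commutativeMonoid = record
    { Carrier = PS
    ; _≈_ = _≈S_
    ; _∙_ = _*S_
    ; ε = oneS
    ; isCommutativeMonoid = record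
      { isMonoid = record
        { isSemigroup = record
          { isMagma = record
            { isEquivalence = record { refl = ≈S-refl ; sym = ≈S-sym ; trans = ≈S-trans }
            ; ∙-cong = *S-cong }
          ; assoc = *S-assoc }
        ; identity = *S-identityˡ , *S-identityʳ }
      ; comm = *S-comm } }

  open CommutativeSemigroupProperties (CommutativeMonoid.commutativeSemigroup *S-commutativeMonoid)
    using () renaming (interchange to *S-interchange; x∙yz≈xz∙y to *S-x∙yz≈xz∙y; x∙yz≈y∙xz to *S-x∙yz≈y∙xz)

  module ≈S-Reasoning = SetoidReasoning (CommutativeMonoid.setoid *S-commutativeMonoid)

  ^S-cong : ∀ {a b} n → a ≈S b → a ^S n ≈S b ^S n
  ^S-cong zero    a≈b = ≈S-refl
  ^S-cong (suc n) a≈b = *S-cong a≈b (^S-cong n a≈b)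

  ^S-+ : ∀ a m n → a ^S (m ℕ.+ n) ≈S a ^S m *S a ^S n
  ^S-+ a zero    n = ≈S-sym (*S-identityˡ (a ^S n))
  ^S-+ a (suc m) n = ≈S-trans (*S-congˡ a (^S-+ a m n)) (≈S-sym (*S-assoc a (a ^S m) (a ^S n)))

  ^S-* : ∀ a m n → a ^S (m ℕ.* n) ≈S (a ^S n) ^S m
  ^S-* a zero    n = ≈S-refl
  ^S-* a (suc m) n = ≈S-trans (^S-+ a n (m ℕ.* n)) (*S-congˡ (a ^S n) (^S-* a m n))

  ^S-distrib-*S : ∀ a b n → (a *S b) ^S n ≈S a ^S n *S b ^S n
  ^S-distrib-*S a b zero    = ≈S-sym (*S-identityˡ oneS)
  ^S-distrib-*S a b (suc n) = ≈S-trans (*S-congˡ (a *S b) (^S-distrib-*S a b n)) (*S-interchange a b (a ^S n) (b ^S n))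

  oneS-^S : ∀ n → oneS ^S n ≈S oneS
  oneS-^S zero    = ≈S-refl
  oneS-^S (suc n) = ≈S-trans (*S-identityˡ (oneS ^S n)) (oneS-^S n)

  prodS-cong : ∀ n {G H : ℕ → PS} → (∀ i → 1 ≤ i → i ≤ n → G i ≈S H i) → prodS n G ≈S prodS n H
  prodS-cong zero    G≈H = ≈S-refl
  prodS-cong (suc n) G≈H =
    *S-cong (prodS-cong n (λ i 1≤i i≤n → G≈H i 1≤i (m≤n⇒m≤1+n i≤n))) (G≈H (suc n) (s≤s z≤n) ≤-refl)

  prodS-*S : ∀ n G H → prodS n (λ i → G i *S H i) ≈S prodS n G *S prodS n H
  prodS-*S zero    G H = ≈S-sym (*S-identityˡ oneS)
  prodS-*S (suc n) G H =
    ≈S-trans (*S-congʳ (G (suc n) *S H (suc n)) (prodS-*S n G H)) (*S-interchange (prodS n G) (prodS n H) (G (suc n)) (H (suc n)))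

  prodS-^S : ∀ n G m → prodS n (λ i → G i ^S m) ≈S prodS n G ^S m
  prodS-^S zero    G m = ≈S-sym (oneS-^S m)
  prodS-^S (suc n) G m =
    ≈S-trans (*S-congʳ (G (suc n) ^S m) (prodS-^S n G m)) (≈S-sym (^S-distrib-*S (prodS n G) (G (suc n)) m))

  *-≉0 : ∀ {x y} → x ≉ 0# → y ≉ 0# → x * y ≉ 0#
  *-≉0 {x} {y} x≉0 y≉0 xy≈0 = y≉0 (begin
    y                ≈⟨ *-identityˡ y ⟨
    1# * y           ≈⟨ *-congʳ (⁻¹-inverse x x≉0) ⟨
    (x * x ⁻¹) * y   ≈⟨ *-congʳ (*-comm x (x ⁻¹)) ⟩
    (x ⁻¹ * x) * y   ≈⟨ *-assoc (x ⁻¹) x y ⟩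
    x ⁻¹ * (x * y)   ≈⟨ *-congˡ xy≈0 ⟩
    x ⁻¹ * 0#        ≈⟨ zeroʳ (x ⁻¹) ⟩
    0#               ∎)
    where open SetoidReasoning setoid

  VanishesBelow : ℕ → PS → Set r
  VanishesBelow p a = ∀ i → i < p → a i ≈ 0#

  HasOrder : ℕ → PS → Set r
  HasOrder p a = VanishesBelow p a × a p ≉ 0#

  VanishesBelow-*S : ∀ {p q a b} → VanishesBelow p a → VanishesBelow q b → VanishesBelow (p ℕ.+ q) (a *S b)
  VanishesBelow-*S {p} {q} {a} {b} a<p≈0 b<q≈0 n n<p+q = sumTo-zero (suc n) term≈0
    where
    term≈0 : ∀ k → k < suc n → a k * b (n ℕ.∸ k) ≈ 0#
    term≈0 k k≤n with k <? p
    ... | yes k<p = trans (*-congʳ (a<p≈0 k k<p)) (zeroˡ _)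
    ... | no  k≮p = trans (*-congˡ (b<q≈0 (n ℕ.∸ k) n∸k<q)) (zeroʳ _)
      where
      n∸k<q : n ℕ.∸ k < q
      n∸k<q = n≤m⇒m<n+o⇒m∸n<o (≤-pred k≤n) (ℕₚ.<-≤-trans n<p+q (ℕₚ.+-monoˡ-≤ q (≮⇒≥ k≮p)))

  *S-at-order : ∀ {p q a b} → VanishesBelow p a → VanishesBelow q b → (a *S b) (p ℕ.+ q) ≈ a p * b q
  *S-at-order {p} {q} {a} {b} a<p≈0 b<q≈0 =
    trans (sumTo-single (suc (p ℕ.+ q)) p (s≤s (m≤m+n p q)) off-diagonal≈0)
          (*-congˡ (reflexive (≡.cong b (m+n∸m≡n p q))))
    where
    off-diagonal≈0 : ∀ i → i < suc (p ℕ.+ q) → i ≢ p → a i * b (p ℕ.+ q ℕ.∸ i) ≈ 0#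
    off-diagonal≈0 i i≤p+q i≢p with i <? p
    ... | yes i<p = trans (*-congʳ (a<p≈0 i i<p)) (zeroˡ _)
    ... | no  i≮p = trans (*-congˡ (b<q≈0 _ p+q∸i<q)) (zeroʳ _)
      where
      p<i : p < i
      p<i = ≤∧≢⇒< (≮⇒≥ i≮p) (λ p≡i → i≢p (≡.sym p≡i))
      p+q∸i<q : p ℕ.+ q ℕ.∸ i < q
      p+q∸i<q = n≤m⇒m<n+o⇒m∸n<o (≤-pred i≤p+q) (ℕₚ.+-monoˡ-< q p<i)

  HasOrder-*S : ∀ {p q a b} → HasOrder p a → HasOrder q b → HasOrder (p ℕ.+ q) (a *S b)
  HasOrder-*S (a<p≈0 , a≉0) (b<q≈0 , b≉0) =
    VanishesBelow-*S a<p≈0 b<q≈0 , λ ab≈0 → *-≉0 a≉0 b≉0 (trans (sym (*S-at-order a<p≈0 b<q≈0)) ab≈0)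

  VanishesBelow-^S : ∀ {h} → VanishesBelow 1 h → ∀ k → VanishesBelow k (h ^S k)
  VanishesBelow-^S h₀≈0 zero    i ()
  VanishesBelow-^S h₀≈0 (suc k) = VanishesBelow-*S h₀≈0 (VanishesBelow-^S h₀≈0 k)

  HasOrder-^S : ∀ {h} → HasOrder 1 h → ∀ k → HasOrder k (h ^S k)
  HasOrder-^S h-order zero    = (λ i ()) , λ 1≈0 → 0≉1 (sym 1≈0)
  HasOrder-^S h-order (suc k) = HasOrder-*S h-order (HasOrder-^S h-order k)

  HasOrder-prodS : ∀ n {G} → (∀ i → 1 ≤ i → i ≤ n → HasOrder 1 (G i)) → HasOrder n (prodS n G)
  HasOrder-prodS zero    G-order = (λ i ()) , λ 1≈0 → 0≉1 (sym 1≈0)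
  HasOrder-prodS (suc n) {G} G-order =
    ≡.subst (λ m → HasOrder m (prodS (suc n) G)) (ℕₚ.+-comm n 1)
      (HasOrder-*S (HasOrder-prodS n (λ i 1≤i i≤n → G-order i 1≤i (m≤n⇒m≤1+n i≤n)))
                   (G-order (suc n) (s≤s z≤n) ≤-refl))

  HasOrder-root : ∀ {h} n → VanishesBelow 1 h → (h ^S suc n) (suc n) ≉ 0# → HasOrder 1 h
  HasOrder-root {h} n h₀≈0 hⁿ⁺¹≉0 =
    h₀≈0 , λ h₁≈0 →
      hⁿ⁺¹≉0 (trans (*S-at-order h₀≈0 (VanishesBelow-^S h₀≈0 n)) (trans (*-congʳ h₁≈0) (zeroˡ _)))

  tS-*S-zero : ∀ a → (tS *S a) 0 ≈ 0#
  tS-*S-zero a = trans (+-identityˡ _) (zeroˡ _)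

  tS-*S-suc : ∀ a n → (tS *S a) (suc n) ≈ a n
  tS-*S-suc a n = trans (sumTo-single (suc (suc n)) 1 (s≤s (s≤s z≤n)) off-1≈0) (*-identityˡ _)
    where
    off-1≈0 : ∀ i → i < suc (suc n) → i ≢ 1 → tS i * a (suc n ℕ.∸ i) ≈ 0#
    off-1≈0 zero          _ _   = zeroˡ _
    off-1≈0 (suc zero)    _ i≢1 = ⊥-elim (i≢1 ≡.refl)
    off-1≈0 (suc (suc i)) _ _   = zeroˡ _

  VanishesBelow-tS-*S : ∀ a → VanishesBelow 1 (tS *S a)
  VanishesBelow-tS-*S a zero    _         = tS-*S-zero a
  VanishesBelow-tS-*S a (suc i) (s≤s ())

  shiftS : ℕ → PS → PS
  shiftS m a n = a (m ℕ.+ n)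

  tS^S-*S-shiftS : ∀ m {a} → VanishesBelow m a → a ≈S tS ^S m *S shiftS m a
  tS^S-*S-shiftS zero    {a} _       = ≈S-sym (*S-identityˡ a)
  tS^S-*S-shiftS (suc m) {a} a<1+m≈0 = begin
    a                                    ≈⟨ a≈tS*shift1 ⟩
    tS *S shiftS 1 a                     ≈⟨ *S-congˡ tS (tS^S-*S-shiftS m (λ i i<m → a<1+m≈0 (suc i) (s≤s i<m))) ⟩
    tS *S (tS ^S m *S shiftS (suc m) a)  ≈⟨ *S-assoc tS (tS ^S m) (shiftS (suc m) a) ⟨
    tS ^S suc m *S shiftS (suc m) a      ∎
    where
    open ≈S-Reasoning
    a≈tS*shift1 : a ≈S tS *S shiftS 1 a
    a≈tS*shift1 zero    = trans (a<1+m≈0 0 (s≤s z≤n)) (sym (tS-*S-zero (shiftS 1 a)))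
    a≈tS*shift1 (suc n) = sym (tS-*S-suc (shiftS 1 a) n)

  lookup-invUpTo : ∀ a n (i : Fin (suc n)) → lookup (invUpTo a n) i ≡ invS a (n ℕ.∸ toℕ i)
  lookup-invUpTo a zero    Fin.zero    = ≡.refl
  lookup-invUpTo a (suc n) Fin.zero    = ≡.refl
  lookup-invUpTo a (suc n) (Fin.suc i) = lookup-invUpTo a n i

  invS-inverseʳ : ∀ a → a 0 ≉ 0# → a *S invS a ≈S oneS
  invS-inverseʳ a a₀≉0 zero    = trans (+-identityˡ _) (⁻¹-inverse _ a₀≉0)
  invS-inverseʳ a a₀≉0 (suc n) = begin
    (a *S invS a) (suc n)                        ≈⟨ sumTo-head (suc n) _ ⟩
    a 0 * invS a (suc n) + S                     ≈⟨ +-congʳ (*-congˡ (*-congˡ sumFin≈S)) ⟩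
    a 0 * (- (a 0 ⁻¹) * S) + S                   ≈⟨ +-congʳ (*-assoc _ _ _) ⟨
    a 0 * - (a 0 ⁻¹) * S + S                     ≈⟨ +-congʳ (*-congʳ (-‿distribʳ-* _ _)) ⟨
    - (a 0 * a 0 ⁻¹) * S + S                     ≈⟨ +-congʳ (*-congʳ (-‿cong (⁻¹-inverse _ a₀≉0))) ⟩
    - 1# * S + S                                 ≈⟨ +-congʳ (-1*x≈-x S) ⟩
    - S + S                                      ≈⟨ -‿inverseˡ S ⟩
    0#                                           ∎
    where
    open SetoidReasoning setoid
    G : ℕ → Carrier
    G k = a (suc k) * invS a (n ℕ.∸ k)
    S : Carrier
    S = sumTo (suc n) G
    sumFin≈S : sumFin (λ i → a (suc (toℕ i)) * lookup (invUpTo a n) i) ≈ S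
    sumFin≈S = sumFin-sumTo (suc n) G (λ i → *-congˡ (reflexive (lookup-invUpTo a n i)))

  divS-*S : ∀ m {a d} → VanishesBelow m a → HasOrder m d → divS m a d *S d ≈S a
  divS-*S m {a} {d} a<m≈0 (d<m≈0 , dₘ≉0) = begin
    a′ *S invS d′ *S d                       ≈⟨ *S-congˡ (a′ *S invS d′) (tS^S-*S-shiftS m d<m≈0) ⟩
    a′ *S invS d′ *S (tS ^S m *S d′)         ≈⟨ *S-x∙yz≈y∙xz (a′ *S invS d′) (tS ^S m) d′ ⟩
    tS ^S m *S (a′ *S invS d′ *S d′)         ≈⟨ *S-congˡ (tS ^S m) (*S-assoc a′ (invS d′) d′) ⟩
    tS ^S m *S (a′ *S (invS d′ *S d′))       ≈⟨ *S-congˡ (tS ^S m) (*S-congˡ a′ (*S-comm (invS d′) d′)) ⟩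
    tS ^S m *S (a′ *S (d′ *S invS d′))       ≈⟨ *S-congˡ (tS ^S m) (*S-congˡ a′ (invS-inverseʳ d′ d′₀≉0)) ⟩
    tS ^S m *S (a′ *S oneS)                  ≈⟨ *S-congˡ (tS ^S m) (*S-identityʳ a′) ⟩
    tS ^S m *S a′                            ≈⟨ tS^S-*S-shiftS m a<m≈0 ⟨
    a                                        ∎
    where
    open ≈S-Reasoning
    a′ d′ : PS
    a′ = shiftS m a
    d′ = shiftS m d
    d′₀≉0 : d′ 0 ≉ 0#
    d′₀≉0 = ≡.subst (λ k → d k ≉ 0#) (≡.sym (ℕₚ.+-identityʳ m)) dₘ≉0

  column-suc : ∀ ℓ .{{_ : NonZero ℓ}} b g f m {p} → p < ℓ →
               column ℓ b g f (suc (m ℕ.* ℓ ℕ.+ p)) ≈S tS *S g *S (prodS p f *S prodS ℓ f ^S m)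
  column-suc ℓ b g f m {p} p<ℓ =
    *S-congˡ (tS *S g) (≈S-trans (beyond (≤⇒≤′ (<⇒≤ p<ℓ)) ≤-refl) (*S-congˡ (prodS p f) (prodS-^S ℓ f m)))
    where
    E Q : ℕ → PS
    E i = f i ^S expo ℓ i (suc (m ℕ.* ℓ ℕ.+ p))
    Q i = f i ^S m
    upTo : ∀ n → n ≤ p → prodS n E ≈S prodS n f *S prodS n Q
    upTo n n≤p = ≈S-trans
      (prodS-cong n (λ i _ i≤n → ≡⇒≈S (≡.cong (f i ^S_) (expo-≤ ℓ m (ℕₚ.≤-trans i≤n n≤p) p<ℓ))))
      (prodS-*S n f Q)
    beyond : ∀ {n} → p ≤′ n → n ≤ ℓ → prodS n E ≈S prodS p f *S prodS n Q
    beyond ≤′-refl _ = upTo p ≤-refl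
    beyond {suc n} (≤′-step p≤′n) 1+n≤ℓ = begin
      prodS n E *S E (suc n)
        ≈⟨ *S-cong (beyond p≤′n (<⇒≤ 1+n≤ℓ)) (≡⇒≈S (≡.cong (f (suc n) ^S_) Eₙ₊₁≡m)) ⟩
      prodS p f *S prodS n Q *S Q (suc n)
        ≈⟨ *S-assoc (prodS p f) (prodS n Q) (Q (suc n)) ⟩
      prodS p f *S prodS (suc n) Q             ∎
      where
      open ≈S-Reasoning
      Eₙ₊₁≡m : expo ℓ (suc n) (suc (m ℕ.* ℓ ℕ.+ p)) ≡ m
      Eₙ₊₁≡m = expo-> ℓ m (s≤s (≤′⇒≤ p≤′n)) 1+n≤ℓ

  *S-compS : ∀ q u {h} → VanishesBelow 1 h → ∀ n →
             (q *S compS u h) n ≈ sumTo (suc n) (λ k → u k * (q *S h ^S k) n)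
  *S-compS q u {h} h₀≈0 n = begin
    sumTo (suc n) (λ i → q i * compS u h (n ℕ.∸ i))
      ≈⟨ sumTo-cong (suc n) (λ i _ →
           *-congˡ (sym (sumTo-extend _ (≤⇒≤′ (s≤s (m∸n≤m n i))) (high-terms≈0 i)))) ⟩
    sumTo (suc n) (λ i → q i * sumTo (suc n) (λ k → u k * (h ^S k) (n ℕ.∸ i)))
      ≈⟨ sumTo-cong (suc n) (λ i _ → *-distribˡ-sumTo (suc n) (q i) _) ⟩
    sumTo (suc n) (λ i → sumTo (suc n) (λ k → q i * (u k * (h ^S k) (n ℕ.∸ i))))
      ≈⟨ sumTo-comm (suc n) (suc n) _ ⟩
    sumTo (suc n) (λ k → sumTo (suc n) (λ i → q i * (u k * (h ^S k) (n ℕ.∸ i))))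
      ≈⟨ sumTo-cong (suc n) (λ k _ → trans (sumTo-cong (suc n) (λ i _ → *-x∙yz≈y∙xz _ _ _))
                                           (sym (*-distribˡ-sumTo (suc n) (u k) _))) ⟩
    sumTo (suc n) (λ k → u k * (q *S h ^S k) n)
      ∎
    where
    open SetoidReasoning setoid
    high-terms≈0 : ∀ i k → suc (n ℕ.∸ i) ≤ k → k < suc n → u k * (h ^S k) (n ℕ.∸ i) ≈ 0#
    high-terms≈0 i k n∸i<k _ = trans (*-congˡ (VanishesBelow-^S h₀≈0 k (n ℕ.∸ i) n∸i<k)) (zeroʳ _)

  *S-^S≈column : ∀ ℓ .{{_ : NonZero ℓ}} b g f {h q} m {p} → p < ℓ → h ^S ℓ ≈S prodS ℓ f →
                 q *S h ^S suc p ≈S tS *S g *S prodS p f →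
                 q *S h ^S suc (m ℕ.* ℓ ℕ.+ p) ≈S column ℓ b g f (suc (m ℕ.* ℓ ℕ.+ p))
  *S-^S≈column ℓ b g f {h} {q} m {p} p<ℓ hˡ≈Πf q-eq = begin
    q *S h ^S suc (m ℕ.* ℓ ℕ.+ p)          ≈⟨ ≡⇒≈S (≡.cong (λ k → q *S h ^S suc k) (ℕₚ.+-comm (m ℕ.* ℓ) p)) ⟩
    q *S h ^S (suc p ℕ.+ m ℕ.* ℓ)          ≈⟨ *S-congˡ q (^S-+ h (suc p) (m ℕ.* ℓ)) ⟩
    q *S (h ^S suc p *S h ^S (m ℕ.* ℓ))    ≈⟨ *S-congˡ q (*S-congˡ (h ^S suc p) (^S-* h m ℓ)) ⟩
    q *S (h ^S suc p *S (h ^S ℓ) ^S m)     ≈⟨ *S-congˡ q (*S-congˡ (h ^S suc p) (^S-cong m hˡ≈Πf)) ⟩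
    q *S (h ^S suc p *S Πf ^S m)           ≈⟨ *S-assoc q (h ^S suc p) (Πf ^S m) ⟨
    q *S h ^S suc p *S Πf ^S m             ≈⟨ *S-congʳ (Πf ^S m) q-eq ⟩
    tS *S g *S prodS p f *S Πf ^S m        ≈⟨ *S-assoc (tS *S g) (prodS p f) (Πf ^S m) ⟩
    tS *S g *S (prodS p f *S Πf ^S m)      ≈⟨ column-suc ℓ b g f m p<ℓ ⟨
    column ℓ b g f (suc (m ℕ.* ℓ ℕ.+ p))   ∎
    where
    open ≈S-Reasoning
    Πf : PS
    Πf = prodS ℓ f

  VanishesBelow-InLat : ∀ {ℓ p u} → InLat ℓ (suc p) u → VanishesBelow 1 u
  VanishesBelow-InLat u-on-lattice zero    _ = u-on-lattice 0 (λ m 0≡ → 0≢1+n (≡.trans 0≡ (+-suc (m ℕ.* _) _)))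
  VanishesBelow-InLat u-on-lattice (suc i) (s≤s ())

  InLat-cases : ∀ {ℓ} .{{_ : NonZero ℓ}} {p u} → p < ℓ → InLat ℓ (suc p) u →
                ∀ k → u k ≈ 0# ⊎ ∃[ m ] k ≡ suc (m ℕ.* ℓ ℕ.+ p)
  InLat-cases p<ℓ u-on-lattice zero = inj₁ (VanishesBelow-InLat u-on-lattice 0 (s≤s z≤n))
  InLat-cases p<ℓ u-on-lattice (suc k) with residue? p<ℓ k
  ... | yes (m , k≡) = inj₂ (m , ≡.cong suc k≡)
  ... | no  k≢       = inj₁ (u-on-lattice (suc k) (λ m 1+k≡ → k≢ (m , suc-injective (≡.trans 1+k≡ (+-suc _ _)))))

  applyD-InLat : ∀ ℓ .{{_ : NonZero ℓ}} b g f {h q u p} → p < ℓ → VanishesBelow 1 h → h ^S ℓ ≈S prodS ℓ f →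
                 q *S h ^S suc p ≈S tS *S g *S prodS p f → InLat ℓ (suc p) u →
                 applyD ℓ b g f u ≈S q *S compS u h
  applyD-InLat ℓ b g f {h} {q} {u} p<ℓ h₀≈0 hˡ≈Πf q-eq u-on-lattice n =
    sym (trans (*S-compS q u h₀≈0 n) (sumTo-cong (suc n) (λ k _ → term k (InLat-cases p<ℓ u-on-lattice k))))
    where
    term : ∀ k → u k ≈ 0# ⊎ ∃[ m ] k ≡ suc (m ℕ.* ℓ ℕ.+ _) → u k * (q *S h ^S k) n ≈ column ℓ b g f k n * u k
    term k (inj₁ uₖ≈0)         = trans (*-congʳ uₖ≈0) (trans (zeroˡ _) (sym (trans (*-congˡ uₖ≈0) (zeroʳ _))))
    term _ (inj₂ (m , ≡.refl)) = trans (*-comm _ _) (*-congʳ (*S-^S≈column ℓ b g f m p<ℓ hˡ≈Πf q-eq n))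

  dropConstS : PS → PS
  dropConstS u zero    = 0#
  dropConstS u (suc n) = u (suc n)

  InLat-dropConstS : ∀ ℓ {u} → InLat ℓ 0 u → InLat ℓ ℓ (dropConstS u)
  InLat-dropConstS ℓ u-on-lattice zero    _        = refl
  InLat-dropConstS ℓ u-on-lattice (suc n) off-ℓℕ+ℓ = u-on-lattice (suc n) off-ℓℕ
    where
    off-ℓℕ : ∀ m → suc n ≢ m ℕ.* ℓ ℕ.+ 0
    off-ℓℕ zero    1+n≡0 = 1+n≢0 1+n≡0
    off-ℓℕ (suc m) 1+n≡ =
      off-ℓℕ+ℓ m (≡.trans 1+n≡ (≡.trans (ℕₚ.+-identityʳ _) (ℕₚ.+-comm ℓ (m ℕ.* ℓ))))

  applyD-dropConstS : ∀ ℓ b g f u n → applyD ℓ b g f u n ≈ u 0 * b n + applyD ℓ b g f (dropConstS u) n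
  applyD-dropConstS ℓ b g f u n = begin
    applyD ℓ b g f u n                      ≈⟨ sumTo-head n _ ⟩
    b n * u 0 + S                           ≈⟨ +-cong (*-comm (b n) (u 0)) (sym (+-identityˡ S)) ⟩
    u 0 * b n + (0# + S)                    ≈⟨ +-congˡ (+-congʳ (zeroʳ (b n))) ⟨
    u 0 * b n + (b n * 0# + S)              ≈⟨ +-congˡ (sumTo-head n _) ⟨
    u 0 * b n + applyD ℓ b g f (dropConstS u) n ∎
    where
    open SetoidReasoning setoid
    S : Carrier
    S = sumTo n (λ k → entry ℓ b g f n (suc k) * u (suc k))

  compS-dropConstS : ∀ u h → subS (compS u h) (constS (u 0)) ≈S compS (dropConstS u) h
  compS-dropConstS u h k = begin
    compS u h k - constS (u 0) k                             ≈⟨ +-congʳ (sumTo-head k _) ⟩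
    u 0 * oneS k + T - constS (u 0) k                        ≈⟨ +-congʳ (+-congʳ (scale-oneS k)) ⟩
    constS (u 0) k + T - constS (u 0) k                      ≈⟨ xyx⁻¹≈y (constS (u 0) k) T ⟩
    T                                                        ≈⟨ +-identityˡ T ⟨
    0# + T                                                   ≈⟨ +-congʳ (zeroˡ (oneS k)) ⟨
    0# * oneS k + T                                          ≈⟨ sumTo-head k _ ⟨
    compS (dropConstS u) h k                                 ∎
    where
    open SetoidReasoning setoid
    T : Carrier
    T = sumTo k (λ i → u (suc i) * (h ^S suc i) k)
    scale-oneS : ∀ k → u 0 * oneS k ≈ constS (u 0) k
    scale-oneS zero    = *-identityʳ (u 0)
    scale-oneS (suc k) = zeroʳ (u 0)

  applyD-InLat₀ : ∀ l' b g f {h q u} → VanishesBelow 1 h → h ^S suc l' ≈S prodS (suc l') f →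
                  q *S f (suc l') ≈S tS *S g → InLat (suc l') 0 u →
                  applyD (suc l') b g f u ≈S addS (scaleS (u 0) b) (q *S subS (compS u h) (constS (u 0)))
  applyD-InLat₀ l' b g f {h} {q} {u} h₀≈0 hˡ≈Πf q-eq u-on-lattice n = begin
    applyD ℓ b g f u n
      ≈⟨ applyD-dropConstS ℓ b g f u n ⟩
    u 0 * b n + applyD ℓ b g f (dropConstS u) n
      ≈⟨ +-congˡ (applyD-InLat ℓ b g f (n<1+n l') h₀≈0 hˡ≈Πf q*hˡ-eq (InLat-dropConstS ℓ u-on-lattice) n) ⟩
    u 0 * b n + (q *S compS (dropConstS u) h) n
      ≈⟨ +-congˡ (*S-congˡ q (compS-dropConstS u h) n) ⟨
    u 0 * b n + (q *S subS (compS u h) (constS (u 0))) n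
      ∎
    where
    open SetoidReasoning setoid
    ℓ : ℕ
    ℓ = suc l'
    q*hˡ-eq : q *S h ^S ℓ ≈S tS *S g *S prodS l' f
    q*hˡ-eq = ≈S-trans (*S-congˡ q hˡ≈Πf)
                (≈S-trans (*S-x∙yz≈xz∙y q (prodS l' f) (f ℓ)) (*S-congʳ (prodS l' f) q-eq))

theorem2p2 : {c r : Level} (F : Field c r) →
    let open Field F in
    let open Series F in
    CharZero →
    (ℓ : ℕ) → 2 ≤ ℓ →
    (b g : PS) → (f : ℕ → PS) → (h : PS) →
    InLat ℓ 0 b → ¬ (b 0 ≈ 0#) →
    InLat ℓ 0 g → ¬ (g 0 ≈ 0#) →
    (∀ i → 1 ≤ i → i ≤ ℓ → InLat ℓ 1 (f i)) →
    (∀ i → 1 ≤ i → i ≤ ℓ → ¬ (f i 1 ≈ 0#)) →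
    h 0 ≈ 0# →
    powS h ℓ ≈S prodS ℓ f →
    ((u : PS) → InLat ℓ 0 u →
       applyD ℓ b g f u
         ≈S addS (scaleS (u 0) b)
                 (mulS (divS 1 (mulS tS g) (f ℓ)) (subS (compS u h) (constS (u 0)))))
    × ((u : PS) → InLat ℓ 1 u →
       applyD ℓ b g f u ≈S mulS (divS 1 (mulS tS g) h) (compS u h))
    × ((j : ℕ) → 2 ≤ j → j < ℓ → (u : PS) → InLat ℓ j u →
       applyD ℓ b g f u
         ≈S mulS (divS j (mulS (mulS tS g) (prodS (j Data.Nat.∸ 1) f)) (powS h j))
                 (compS u h))
theorem2p2 F _ ℓ@(suc l') (s≤s _) b g f h _ _ _ _ f-on-lattice f₁≉0 h₀≈0 hˡ≈Πf =
    (λ _ → applyD-InLat₀ l' b g f h<1≈0 hˡ≈Πf (divS-*S 1 (VanishesBelow-tS-*S g) (f-order ℓ (s≤s z≤n) ≤-refl)))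
  , (λ _ → applyD-InLat ℓ b g f (s≤s z≤n) h<1≈0 hˡ≈Πf q*h≈tS*g)
  , λ { (suc p) (s≤s _) 1+p<ℓ _ → applyD-InLat ℓ b g f (<⇒≤ 1+p<ℓ) h<1≈0 hˡ≈Πf (q*hᵖ⁺¹≈tS*g*Πf (<⇒≤ 1+p<ℓ)) }
  where
  open Field F using (sym; trans)
  open Series F
  open PowerSeries F
  f-order : ∀ i → 1 ≤ i → i ≤ ℓ → HasOrder 1 (f i)
  f-order i 1≤i i≤ℓ = VanishesBelow-InLat (f-on-lattice i 1≤i i≤ℓ) , f₁≉0 i 1≤i i≤ℓ
  h<1≈0 : VanishesBelow 1 h
  h<1≈0 zero    _        = h₀≈0
  h<1≈0 (suc i) (s≤s ())
  h-order : HasOrder 1 h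
  h-order = HasOrder-root l' h<1≈0 (λ hˡₗ≈0 → proj₂ (HasOrder-prodS ℓ f-order) (trans (sym (hˡ≈Πf ℓ)) hˡₗ≈0))
  q*h≈tS*g : divS 1 (tS *S g) h *S h ^S 1 ≈S tS *S g *S prodS 0 f
  q*h≈tS*g = ≈S-trans (*S-congˡ (divS 1 (tS *S g) h) (*S-identityʳ h))
               (≈S-trans (divS-*S 1 (VanishesBelow-tS-*S g) h-order) (≈S-sym (*S-identityʳ (tS *S g))))
  q*hᵖ⁺¹≈tS*g*Πf : ∀ {p} → p < ℓ →
    divS (suc p) (tS *S g *S prodS p f) (h ^S suc p) *S h ^S suc p ≈S tS *S g *S prodS p f
  q*hᵖ⁺¹≈tS*g*Πf {p} p<ℓ =
    divS-*S (suc p) (VanishesBelow-*S (VanishesBelow-tS-*S g) (proj₁ (HasOrder-prodS p f-order-≤p)))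
                    (HasOrder-^S h-order (suc p))
    where
    f-order-≤p : ∀ i → 1 ≤ i → i ≤ p → HasOrder 1 (f i)
    f-order-≤p i 1≤i i≤p = f-order i 1≤i (ℕₚ.≤-trans i≤p (<⇒≤ p<ℓ))
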